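{- For all integers $n\ge m\ge 1$, $\mathrm{opt}^{P}_{B}(T_{n,m}) \ge \frac{m-1}{2}$.
   Context: $T_{n,m}$ is the $n\times m$ torus grid: squares $(i,j)$ with row indices taken modulo $n$ and column indices modulo $m$. Some squares are occupied by blocks; a single robot starts on a free square (say $(1,1)$). A move: choose one of the four directions; the robot slides (wrapping around) and stops on the last free square before a block. If the row or column along which it moves contains no block, the robot passes over every square of that line and ends where it started. The robot passes over every square it occupies during a move. A set of blocks is a solution of the block/pass game if every free square is passed over during some sequence of moves from the starting square. $\mathrm{opt}^{P}_{B}(T_{n,m})$ is the minimum number of blocks in a solution. -}

module Defs where

open import Data.Nat using (ℕ; zero; suc; _+_; _*_; _≤_)
open import Data.Nat.DivMod using (_mod_)
open import Data.Fin using (Fin; toℕ) renaming (zero to fzero)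
open import Data.Bool using (Bool; true; false; if_then_else_)
open import Data.List using (List; map; allFin)
open import Data.Nat.ListAction using (sum)
open import Data.Product using (_×_; _,_; ∃; ∃-syntax)
open import Data.Sum using (_⊎_)
open import Relation.Binary.PropositionalEquality using (_≡_)

-- The torus T_{n,m} with n = suc n' rows and m = suc m' columns.
-- Coordinates are 0-based: the paper's square (1,1) is (fzero , fzero).
Square : ℕ → ℕ → Set
Square n' m' = Fin (suc n') × Fin (suc m')

Blocks : ℕ → ℕ → Set
Blocks n' m' = Fin (suc n') → Fin (suc m') → Bool

nBlocks : ∀ {n' m'} → Blocks n' m' → ℕ
nBlocks {n'} {m'} B =
  sum (map (λ i → sum (map (λ j → if B i j then 1 else 0) (allFin (suc m')))) (allFin (suc n')))

Free : ∀ {n' m'} → Blocks n' m' → Square n' m' → Set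
Free B (i , j) = B i j ≡ false

Blocked : ∀ {n' m'} → Blocks n' m' → Square n' m' → Set
Blocked B (i , j) = B i j ≡ true

shift : ∀ {k} → ℕ → Fin (suc k) → Fin (suc k)
shift {k} d x = (toℕ x + d) mod (suc k)

data Dir : Set where
  up down left right : Dir

-- one unit step in a direction (with wrap-around); "minus one" is "plus (side − 1)"
step : ∀ {n' m'} → Dir → Square n' m' → Square n' m'
step {n'} {m'} up    (i , j) = shift n' i , j
step {n'} {m'} down  (i , j) = shift 1 i , j
step {n'} {m'} left  (i , j) = i , shift m' j
step {n'} {m'} right (i , j) = i , shift 1 j

steps : ∀ {n' m'} → Dir → ℕ → Square n' m' → Square n' m'
steps d zero    p = p
steps d (suc k) p = step d (steps d k p)

FreeUpTo : ∀ {n' m'} → Blocks n' m' → Dir → Square n' m' → ℕ → Set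
FreeUpTo B d p k = ∀ j → j ≤ k → Free B (steps d j p)

-- x is passed over during the move in direction d starting at p
-- (the robot slides over consecutive free squares; if the line has no block
--  it passes over the whole line)
PassesOver : ∀ {n' m'} → Blocks n' m' → Dir → Square n' m' → Square n' m' → Set
PassesOver B d p x = ∃[ k ] (FreeUpTo B d p k × steps d k p ≡ x)

-- the move in direction d starting at p ends at q:
-- either it stops at the last free square before a block, or the line has no
-- block and the robot returns to its starting square.
MoveEnds : ∀ {n' m'} → Blocks n' m' → Dir → Square n' m' → Square n' m' → Set
MoveEnds B d p q =
  (∃[ k ] (FreeUpTo B d p k × Blocked B (steps d (suc k) p) × steps d k p ≡ q))
  ⊎ ((∀ k → Free B (steps d k p)) × q ≡ p)

start : ∀ {n' m'} → Square n' m'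
start = fzero , fzero

data Reachable {n' m'} (B : Blocks n' m') : Square n' m' → Set where
  here : Reachable B start
  move : ∀ {p q} d → Reachable B p → MoveEnds B d p q → Reachable B q

IsSolution : ∀ {n' m'} → Blocks n' m' → Set
IsSolution B =
  Free B start ×
  (∀ x → Free B x → ∃[ p ] ∃[ d ] (Reachable B p × PassesOver B d p x))

module Submission where

-- The robot can only stop next to a block.  Hence (row invariant) every row
-- it ever stands in is row 0 or a cyclic neighbour of the row of some block,
-- and (column invariant) every column it stands in is column 0 or a cyclic
-- neighbour of the column of a block lying in such an "enterable" row.
-- Each block therefore accounts for at most two rows (resp. columns), and a
-- pigeonhole count turns "every row/column is accounted for" into the bound
-- size ≤ 1 + 2·(number of blocks).
--   * If every row is enterable, this gives n - 1 ≤ 2|B|, and m ≤ n.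
--   * Otherwise some row i₀ is never entered, so each free square of it is
--     passed over by a vertical move and its column satisfies the column
--     invariant with a block outside row i₀; a blocked square of row i₀
--     accounts for its own column.  Counting columns gives m - 1 ≤ 2|B|.

open import Defs
open import Data.Nat using (ℕ; zero; suc; _+_; _*_; _%_; _≤_; _∸_; _≤?_; s≤s⁻¹; NonZero)
open import Data.Nat.Properties using (+-assoc; +-comm; +-identityʳ; ≤-trans; ≰⇒>)
open import Data.Nat.DivMod using ([m+n]%n≡m%n; m<n⇒m%n≡m; m%n<n; %-distribˡ-+; m%n%n≡m%n)
open import Data.Nat.ListAction using (sum)
open import Data.Fin using (Fin; toℕ) renaming (zero to fzero)
open import Data.Fin.Properties
  using (toℕ-injective; toℕ-fromℕ<; toℕ<n; pigeonhole; <-irrefl; any?; all?; ¬∀⟶∃¬)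
  renaming (_≟_ to _≟ᶠ_)
open import Data.Bool using (true; false; if_then_else_)
open import Data.Bool.Properties using () renaming (_≟_ to _≟ᵇ_)
open import Data.List using (List; []; _∷_; [_]; _++_; map; concatMap; allFin; length; lookup)
open import Data.List.Properties using (length-++; length-map; map-cong)
open import Data.List.Membership.Propositional using (_∈_; lose)
open import Data.List.Membership.Propositional.Properties
  using (∈-++⁺ˡ; ∈-++⁺ʳ; ∈-map⁺; ∈-allFin; ∈-concatMap⁺)
open import Data.List.Relation.Unary.Any using (here; there; index)
open import Data.List.Relation.Unary.Any.Properties using (lookup-index)
open import Data.Product using (_×_; _,_; ∃-syntax; proj₁; proj₂)
open import Data.Sum using (_⊎_; inj₁; inj₂)
open import Data.Empty using (⊥-elim)
open import Relation.Nullary using (¬_; Dec; yes; no)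
open import Relation.Nullary.Decidable using (_×-dec_; _⊎-dec_; ⌊_⌋)
open import Relation.Binary.PropositionalEquality
  using (_≡_; refl; sym; trans; cong; cong₂; subst; module ≡-Reasoning)

toℕ-shift : ∀ {k} d (x : Fin (suc k)) → toℕ (shift d x) ≡ (toℕ x + d) % suc k
toℕ-shift {k} d x = toℕ-fromℕ< (m%n<n (toℕ x + d) (suc k))

[m%d+n]%d≡[m+n]%d : ∀ m n d .{{_ : NonZero d}} → (m % d + n) % d ≡ (m + n) % d
[m%d+n]%d≡[m+n]%d m n d = begin
  (m % d + n) % d            ≡⟨ %-distribˡ-+ (m % d) n d ⟩
  (m % d % d + n % d) % d    ≡⟨ cong (λ y → (y + n % d) % d) (m%n%n≡m%n m d) ⟩
  (m % d + n % d) % d        ≡⟨ %-distribˡ-+ m n d ⟨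
  (m + n) % d                ∎
  where open ≡-Reasoning

toℕ-shift-shift : ∀ {k} a b (x : Fin (suc k)) →
  toℕ (shift b (shift a x)) ≡ (toℕ x + a + b) % suc k
toℕ-shift-shift {k} a b x = begin
  toℕ (shift b (shift a x))          ≡⟨ toℕ-shift b (shift a x) ⟩
  (toℕ (shift a x) + b) % suc k      ≡⟨ cong (λ y → (y + b) % suc k) (toℕ-shift a x) ⟩
  ((toℕ x + a) % suc k + b) % suc k  ≡⟨ [m%d+n]%d≡[m+n]%d (toℕ x + a) b (suc k) ⟩
  (toℕ x + a + b) % suc k            ∎
  where open ≡-Reasoning

shift-cancel : ∀ {k} a b → a + b ≡ suc k → (x : Fin (suc k)) → shift b (shift a x) ≡ x
shift-cancel {k} a b a+b≡k+1 x = toℕ-injective (begin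
  toℕ (shift b (shift a x))  ≡⟨ toℕ-shift-shift a b x ⟩
  (toℕ x + a + b) % suc k    ≡⟨ cong (_% suc k) (+-assoc (toℕ x) a b) ⟩
  (toℕ x + (a + b)) % suc k  ≡⟨ cong (λ y → (toℕ x + y) % suc k) a+b≡k+1 ⟩
  (toℕ x + suc k) % suc k    ≡⟨ [m+n]%n≡m%n (toℕ x) (suc k) ⟩
  toℕ x % suc k              ≡⟨ m<n⇒m%n≡m (toℕ<n x) ⟩
  toℕ x                      ∎)
  where open ≡-Reasoning

Adjacent : ∀ {k} → Fin (suc k) → Fin (suc k) → Set
Adjacent {k} x y = x ≡ shift 1 y ⊎ x ≡ shift k y

Adjacent? : ∀ {k} (x y : Fin (suc k)) → Dec (Adjacent x y)
Adjacent? {k} x y = (x ≟ᶠ shift 1 y) ⊎-dec (x ≟ᶠ shift k y)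

enumeration-length : ∀ {K} (L : List (Fin K)) → (∀ x → x ∈ L) → K ≤ length L
enumeration-length {K} L complete with K ≤? length L
... | yes K≤len = K≤len
... | no K≰len with pigeonhole (≰⇒> K≰len) (λ x → index (complete x))
... | i , j , i<j , same-index = ⊥-elim (<-irrefl i≡j i<j)
  where
  i≡j : i ≡ j
  i≡j = trans (lookup-index (complete i))
          (trans (cong (lookup L) same-index) (sym (lookup-index (complete j))))

length-concatMap : ∀ {A C : Set} (f : A → List C) (xs : List A) →
  length (concatMap f xs) ≡ sum (map (λ x → length (f x)) xs)
length-concatMap f []       = refl
length-concatMap f (x ∷ xs) =
  trans (length-++ (f x)) (cong (length (f x) +_) (length-concatMap f xs))

blockedCell : ∀ {n' m'} → Blocks n' m' → Fin (suc n') → Fin (suc m') → List (Square n' m')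
blockedCell B i j = if B i j then [ (i , j) ] else []

blockedInRow : ∀ {n' m'} → Blocks n' m' → Fin (suc n') → List (Square n' m')
blockedInRow {m' = m'} B i = concatMap (blockedCell B i) (allFin (suc m'))

blockedSquares : ∀ {n' m'} → Blocks n' m' → List (Square n' m')
blockedSquares {n'} B = concatMap (blockedInRow B) (allFin (suc n'))

∈-blockedSquares : ∀ {n' m'} (B : Blocks n' m') i j → B i j ≡ true → (i , j) ∈ blockedSquares B
∈-blockedSquares B i j blocked =
  ∈-concatMap⁺ (blockedInRow B) (lose (∈-allFin i)
    (∈-concatMap⁺ (blockedCell B i) (lose (∈-allFin j) in-cell)))
  where
  in-cell : (i , j) ∈ blockedCell B i j
  in-cell rewrite blocked = here refl

length-blockedSquares : ∀ {n' m'} (B : Blocks n' m') → length (blockedSquares B) ≡ nBlocks B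
length-blockedSquares {n'} {m'} B =
  trans (length-concatMap (blockedInRow B) (allFin (suc n')))
        (cong sum (map-cong length-blockedInRow (allFin (suc n'))))
  where
  length-blockedCell : ∀ i j → length (blockedCell B i j) ≡ (if B i j then 1 else 0)
  length-blockedCell i j with B i j
  ... | true  = refl
  ... | false = refl

  length-blockedInRow : ∀ i →
    length (blockedInRow B i) ≡ sum (map (λ j → if B i j then 1 else 0) (allFin (suc m')))
  length-blockedInRow i = trans (length-concatMap (blockedCell B i) (allFin (suc m')))
    (cong sum (map-cong (length-blockedCell i) (allFin (suc m'))))

two-per-block-bound : ∀ {n' m' K} (B : Blocks n' m') (x₀ : Fin K) (f g : Square n' m' → Fin K) →
  (∀ y → y ≡ x₀ ⊎ ∃[ i ] ∃[ j ] (B i j ≡ true × (y ≡ f (i , j) ⊎ y ≡ g (i , j)))) →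
  K ≤ suc (2 * nBlocks B)
two-per-block-bound {n'} {m'} {K} B x₀ f g covered =
  subst (K ≤_) length-images (enumeration-length images complete)
  where
  S : List (Square n' m')
  S = blockedSquares B

  images : List (Fin K)
  images = x₀ ∷ map f S ++ map g S

  complete : ∀ y → y ∈ images
  complete y with covered y
  ... | inj₁ refl = here refl
  ... | inj₂ (i , j , blocked , inj₁ refl) =
    there (∈-++⁺ˡ (∈-map⁺ f (∈-blockedSquares B i j blocked)))
  ... | inj₂ (i , j , blocked , inj₂ refl) =
    there (∈-++⁺ʳ (map f S) (∈-map⁺ g (∈-blockedSquares B i j blocked)))

  length-images : length images ≡ suc (2 * nBlocks B)
  length-images = cong suc (begin
    length (map f S ++ map g S)       ≡⟨ length-++ (map f S) ⟩
    length (map f S) + length (map g S) ≡⟨ cong₂ _+_ (length-map f S) (length-map g S) ⟩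
    length S + length S               ≡⟨ cong (length S +_) (+-identityʳ (length S)) ⟨
    2 * length S                      ≡⟨ cong (2 *_) (length-blockedSquares B) ⟩
    2 * nBlocks B                     ∎)
    where open ≡-Reasoning

row : ∀ {n' m'} → Square n' m' → Fin (suc n')
row = proj₁

col : ∀ {n' m'} → Square n' m' → Fin (suc m')
col = proj₂

data Horizontal : Dir → Set where
  left  : Horizontal left
  right : Horizontal right

data Vertical : Dir → Set where
  up   : Vertical up
  down : Vertical down

horizontal-or-vertical : ∀ d → Horizontal d ⊎ Vertical d
horizontal-or-vertical up    = inj₂ up
horizontal-or-vertical down  = inj₂ down
horizontal-or-vertical left  = inj₁ left
horizontal-or-vertical right = inj₁ right

steps-keep-row : ∀ {n' m' d} → Horizontal d → ∀ k (p : Square n' m') → row (steps d k p) ≡ row p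
steps-keep-row h zero    p = refl
steps-keep-row left  (suc k) p = steps-keep-row left k p
steps-keep-row right (suc k) p = steps-keep-row right k p

steps-keep-col : ∀ {n' m' d} → Vertical d → ∀ k (p : Square n' m') → col (steps d k p) ≡ col p
steps-keep-col v zero    p = refl
steps-keep-col up   (suc k) p = steps-keep-col up k p
steps-keep-col down (suc k) p = steps-keep-col down k p

step-row-adjacent : ∀ {n' m' d} → Vertical d → (p : Square n' m') → Adjacent (row p) (row (step d p))
step-row-adjacent {n'} up   p = inj₁ (sym (shift-cancel n' 1 (+-comm n' 1) (row p)))
step-row-adjacent {n'} down p = inj₂ (sym (shift-cancel 1 n' refl (row p)))

step-col-adjacent : ∀ {n' m' d} → Horizontal d → (p : Square n' m') → Adjacent (col p) (col (step d p))
step-col-adjacent {m' = m'} left  p = inj₁ (sym (shift-cancel m' 1 (+-comm m' 1) (col p)))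
step-col-adjacent {m' = m'} right p = inj₂ (sym (shift-cancel 1 m' refl (col p)))

move-end : ∀ {n' m'} {B : Blocks n' m'} {d p q} → MoveEnds B d p q →
  q ≡ p ⊎ ((∃[ k ] steps d k p ≡ q) × Blocked B (step d q))
move-end (inj₁ (k , _ , blocked , refl)) = inj₂ ((k , refl) , blocked)
move-end (inj₂ (_ , q≡p))                = inj₁ q≡p

passes-over-row : ∀ {n' m'} {B : Blocks n' m'} {d p x} → Horizontal d → PassesOver B d p x → row x ≡ row p
passes-over-row h (k , _ , reaches) = trans (cong row (sym reaches)) (steps-keep-row h k _)

passes-over-col : ∀ {n' m'} {B : Blocks n' m'} {d p x} → Vertical d → PassesOver B d p x → col x ≡ col p
passes-over-col v (k , _ , reaches) = trans (cong col (sym reaches)) (steps-keep-col v k _)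

EnterableRow : ∀ {n' m'} → Blocks n' m' → Fin (suc n') → Set
EnterableRow B i = i ≡ fzero ⊎ ∃[ r ] ∃[ c ] (B r c ≡ true × Adjacent i r)

EnterableRow? : ∀ {n' m'} (B : Blocks n' m') i → Dec (EnterableRow B i)
EnterableRow? B i =
  (i ≟ᶠ fzero) ⊎-dec any? (λ r → any? (λ c → (B r c ≟ᵇ true) ×-dec Adjacent? i r))

EnterableCol : ∀ {n' m'} → Blocks n' m' → Fin (suc m') → Set
EnterableCol B j = j ≡ fzero ⊎ ∃[ r ] ∃[ c ] (B r c ≡ true × Adjacent j c × EnterableRow B r)

-- Row invariant: a vertical move stops in a row adjacent to its block's row.
reachable-row : ∀ {n' m'} {B : Blocks n' m'} {q} → Reachable B q → EnterableRow B (row q)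
reachable-row here = inj₁ refl
reachable-row {B = B} (move {p} d reach ends) with move-end {B = B} ends
... | inj₁ refl = reachable-row reach
... | inj₂ ((k , refl) , blocked) with horizontal-or-vertical d
...   | inj₁ h = subst (EnterableRow B) (sym (steps-keep-row h k p)) (reachable-row reach)
...   | inj₂ v = inj₂ (row (step d (steps d k p)) , col (step d (steps d k p)) ,
                      blocked , step-row-adjacent v (steps d k p))

-- Column invariant: a horizontal move stops in a column adjacent to its
-- block's column, and that block lies in the (enterable) row of the stop.
reachable-col : ∀ {n' m'} {B : Blocks n' m'} {q} → Reachable B q → EnterableCol B (col q)
reachable-col here = inj₁ refl
reachable-col {n'} {m'} {B} (move {p} d reach ends) with move-end {B = B} ends
... | inj₁ refl = reachable-col reach
... | inj₂ ((k , refl) , blocked) with horizontal-or-vertical d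
...   | inj₂ v = subst (EnterableCol B) (sym (steps-keep-col v k p)) (reachable-col reach)
...   | inj₁ h = inj₂ (row (step d q) , col (step d q) ,
                      blocked , step-col-adjacent h q , block-row-enterable)
  where
  q : Square n' m'
  q = steps d k p

  -- the block lies in the row of the reachable square q where the move stops
  block-row-enterable : EnterableRow B (row (step d q))
  block-row-enterable =
    subst (EnterableRow B) (sym (steps-keep-row h 1 q)) (reachable-row (move d reach ends))

-- If the robot can enter every row, the n rows are accounted for by row 0
-- and the two neighbouring rows of each block.
all-rows-enterable-bound : ∀ {n' m'} (B : Blocks n' m') → (∀ i → EnterableRow B i) →
  n' ≤ 2 * nBlocks B
all-rows-enterable-bound {n'} B enterable =
  s≤s⁻¹ (two-per-block-bound B fzero (λ s → shift 1 (row s)) (λ s → shift n' (row s)) enterable)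

-- If row i₀ can never be entered, every column is accounted for by column 0,
-- the right neighbour of the column of a block, and either the column of a
-- block in row i₀ itself or the left neighbour of the column of any other block.
unenterable-row-bound : ∀ {n' m'} (B : Blocks n' m') → IsSolution B →
  ∀ i₀ → ¬ EnterableRow B i₀ → m' ≤ 2 * nBlocks B
unenterable-row-bound {n'} {m'} B (_ , passed) i₀ unenterable =
  s≤s⁻¹ (two-per-block-bound B fzero (λ s → shift 1 (col s)) partner covered)
  where
  partner : Square n' m' → Fin (suc m')
  partner (r , c) = if ⌊ r ≟ᶠ i₀ ⌋ then c else shift m' c

  partner-in-i₀ : ∀ c → partner (i₀ , c) ≡ c
  partner-in-i₀ c with i₀ ≟ᶠ i₀
  ... | yes _   = refl
  ... | no i₀≢i₀ = ⊥-elim (i₀≢i₀ refl)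

  partner-elsewhere : ∀ r c → ¬ r ≡ i₀ → partner (r , c) ≡ shift m' c
  partner-elsewhere r c r≢i₀ with r ≟ᶠ i₀
  ... | yes r≡i₀ = ⊥-elim (r≢i₀ r≡i₀)
  ... | no _     = refl

  Covered : Fin (suc m') → Set
  Covered j = j ≡ fzero ⊎ ∃[ r ] ∃[ c ] (B r c ≡ true × (j ≡ shift 1 c ⊎ j ≡ partner (r , c)))

  -- a block in an enterable row is not in row i₀, so its partner is its left neighbour
  enterable-covered : ∀ j → EnterableCol B j → Covered j
  enterable-covered j (inj₁ j≡0) = inj₁ j≡0
  enterable-covered j (inj₂ (r , c , blocked , inj₁ j≡c+1 , _)) = inj₂ (r , c , blocked , inj₁ j≡c+1)
  enterable-covered j (inj₂ (r , c , blocked , inj₂ j≡c-1 , r-enterable)) =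
    inj₂ (r , c , blocked , inj₂ (trans j≡c-1 (sym (partner-elsewhere r c r≢i₀))))
    where
    r≢i₀ : ¬ r ≡ i₀
    r≢i₀ r≡i₀ = unenterable (subst (EnterableRow B) r≡i₀ r-enterable)

  -- a free square (i₀ , j) is passed over by a move from a reachable square,
  -- which cannot be horizontal (that square would lie in row i₀)
  covered : ∀ j → Covered j
  covered j with B i₀ j in i₀j-blocked
  ... | true  = inj₂ (i₀ , j , i₀j-blocked , inj₂ (sym (partner-in-i₀ j)))
  ... | false with passed (i₀ , j) i₀j-blocked
  ...   | p , d , reach , passes with horizontal-or-vertical d
  ...     | inj₁ h = ⊥-elim (unenterable
              (subst (EnterableRow B) (sym (passes-over-row {B = B} h passes)) (reachable-row reach)))
  ...     | inj₂ v = enterable-covered j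
              (subst (EnterableCol B) (sym (passes-over-col {B = B} v passes)) (reachable-col reach))

mainTheorem3 : ∀ (n' m' : ℕ) → m' ≤ n' → (B : Blocks n' m') → IsSolution B →
    suc m' ∸ 1 ≤ 2 * nBlocks B
mainTheorem3 n' m' m'≤n' B solution with all? (EnterableRow? B)
... | yes every-row = ≤-trans m'≤n' (all-rows-enterable-bound B every-row)
... | no ¬every-row with ¬∀⟶∃¬ (suc n') (EnterableRow B) (EnterableRow? B) ¬every-row
...   | i₀ , unenterable = unenterable-row-bound B solution i₀ unenterable
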